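{- Let $n>1$ be an integer, $d\geq2$ an integer and $r$ an integer with $n-\lfloor (n-1)d/2\rfloor\leq r\leq n$ and $n\equiv r\pmod d$. Let $\{c(k)\}_{k=0}^\infty$ be a sequence of complex numbers. If $c(k)=0$ for all integers $k$ with $(n-r)/d<k\leq n-1$, then $$\sum_{k=0}^{n-1}\sum_{j=0}^{k}c(j)c(k-j)=\bigg(\sum_{j=0}^{\frac{n-r}{d}}c(j)\bigg)^2.$$ Furthermore, if in addition $c(ln+k)/c(ln)=c(k)$ for all nonnegative integers $k$ and $l$ with $0\leq k\leq n-1$, then for all such $l,k$ $$\sum_{j=0}^{ln+k}c(j)c(ln+k-j)=\sum_{t=0}^{l}c(tn)c((l-t)n)\sum_{j=0}^{k}c(j)c(k-j).$$ -}

module Defs where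

open import Algebra.Bundles using (CommutativeRing)
open import Data.Nat using (ℕ; zero; suc; _∸_)

module Sums {a ℓ} (R : CommutativeRing a ℓ) where
  open CommutativeRing R

  sumTo : (ℕ → Carrier) → ℕ → Carrier
  sumTo f zero    = f 0
  sumTo f (suc m) = sumTo f m + f (suc m)

  conv : (ℕ → Carrier) → ℕ → Carrier
  conv c k = sumTo (λ j → c j * c (k ∸ j)) k

-- Write N = n − 1 and m = (n − r)/d. The lower bound on r forces 2m ≤ N, so
-- c lives on [0, m] inside [0, N], and any product c(a)c(b) with a, b ≤ N and a + b ≥ n
-- has a factor outside [0, m] and vanishes.
-- First sum: Σ_{K ≤ N} Σ_{j ≤ K} c(j)c(K−j) = Σ_{i ≤ N} c(i) Σ_{j ≤ N−i} c(j); for c(i) ≠ 0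
-- we have i ≤ m, so N − i ≥ m and the inner sum is Σ_{j ≤ m} c(j).
-- Second sum: split j ∈ [0, ln + k] as j = sn + a with a < n. By the block multiplicativity
-- c(sn + a) = c(sn)c(a), a term c(sn + a)c(ln + k − sn − a) is c(sn)c((l−s)n)·c(a)c(k−a)
-- when a ≤ k, and for a > k it is c(sn)c((l−s−1)n)·c(a)c(n + k − a), which vanishes.
module Submission where

open import Defs
open import Algebra.Bundles using (CommutativeRing)
open import Data.Nat as ℕ using (ℕ; NonZero)
open import Data.Integer as ℤ using (ℤ; +_; ∣_∣)
open import Data.Integer.Divisibility as ℤD using ()
open import Data.Product using (_×_; _,_; proj₂)
open import Relation.Nullary using (¬_; yes; no; contradiction)

open import Data.Nat using (zero; suc; _∸_; _≤_; _<_; _≤′_; s≤s; z≤n; ≤′-reflexive; ≤′-step; _≤?_)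
open import Data.Nat.Properties as ℕP
  using (≤-refl; ≤-trans; <⇒≤; ≰⇒>; n≮n; ≤⇒≤′; ≤′⇒≤; m≤n⇒m≤1+n; m<n⇒m<1+n; m≤n+m; m≤o∸n⇒m+n≤o; +-suc; +-mono-≤; +-monoʳ-≤;
         *-monoˡ-≤; m*n≢0; m+n≤o⇒m≤o; m+n≤o⇒n≤o; m+n≤o⇒m≤o∸n; m∸n≤m; n∸n≡0; m+n∸m≡n; m+[n∸m]≡n; +-∸-assoc; module ≤-Reasoning)
open import Data.Nat.DivMod using (m/n*n≤m; /-monoˡ-≤; m/n/o≡m/[n*o]; m*n/o*n≡m/o)
import Data.Integer.Properties as ℤP
import Data.Nat.Tactic.RingSolver as ℕSolver
import Data.Integer.Tactic.RingSolver as ℤSolver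
import Algebra.Properties.CommutativeSemigroup as CommSemigroupProperties
open import Relation.Binary.PropositionalEquality as ≡ using (_≡_; cong; subst)

module _ where
  open import Data.Nat using (_+_; _*_; _/_)
  open ≡ using (refl; sym; trans; cong₂)

  m≤n/2⇒m+m≤n : ∀ {m n} → m ≤ n / 2 → m + m ≤ n
  m≤n/2⇒m+m≤n {m} {n} m≤n/2 = begin
    m + m      ≡⟨ cong (_+_ m) (ℕP.+-identityʳ m) ⟨
    2 * m      ≡⟨ ℕP.*-comm 2 m ⟩
    m * 2      ≤⟨ *-monoˡ-≤ 2 m≤n/2 ⟩
    n / 2 * 2  ≤⟨ m/n*n≤m n 2 ⟩
    n          ∎
    where open ≤-Reasoning

  ∣i-j∣≤h : ∀ {i j : ℤ} {h : ℕ} → i ℤ.- + h ℤ.≤ j → j ℤ.≤ i → ∣ i ℤ.- j ∣ ≤ h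
  ∣i-j∣≤h {i} {j} {h} lo hi = ℤP.drop‿+≤+ (begin
    + ∣ i ℤ.- j ∣                  ≡⟨ ℤP.0≤i⇒+∣i∣≡i (ℤP.i≤j⇒0≤j-i hi) ⟩
    i ℤ.- j                        ≡⟨ telescope i (+ h) j ⟨
    (i ℤ.- + h) ℤ.+ (+ h ℤ.- j)    ≤⟨ ℤP.+-monoˡ-≤ (+ h ℤ.- j) lo ⟩
    j ℤ.+ (+ h ℤ.- j)              ≡⟨ cancel (+ h) j ⟩
    + h                            ∎)
    where
      open ℤP.≤-Reasoning
      telescope : ∀ x y z → (x ℤ.- y) ℤ.+ (y ℤ.- z) ≡ x ℤ.- z
      telescope = ℤSolver.solve-∀
      cancel : ∀ y z → z ℤ.+ (y ℤ.- z) ≡ y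
      cancel = ℤSolver.solve-∀

  window-bound : ∀ n d (r : ℤ) ⦃ _ : NonZero d ⦄
               → + n ℤ.- + ((n ∸ 1) * d / 2) ℤ.≤ r → r ℤ.≤ + n
               → let m = ∣ + n ℤ.- r ∣ / d in m + m ≤ n ∸ 1
  window-bound n d r lo hi = m≤n/2⇒m+m≤n (begin
    ∣ + n ℤ.- r ∣ / d        ≤⟨ /-monoˡ-≤ d (∣i-j∣≤h lo hi) ⟩
    (n ∸ 1) * d / 2 / d      ≡⟨ m/n/o≡m/[n*o] ((n ∸ 1) * d) 2 d ⟩
    (n ∸ 1) * d / (2 * d)    ≡⟨ m*n/o*n≡m/o (n ∸ 1) d 2 ⟩
    (n ∸ 1) / 2              ∎)
    where
      open ≤-Reasoning
      instance _ = m*n≢0 2 d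

  ∸-from-+ : ∀ x {y z} → x + y ≡ z → z ∸ x ≡ y
  ∸-from-+ x {y} refl = m+n∸m≡n x y

  within-block-index : ∀ n {s l a k} → s ≤ l → a ≤ k
                     → (l * n + k) ∸ (s * n + a) ≡ (l ∸ s) * n + (k ∸ a)
  within-block-index n {s} {l} {a} {k} s≤l a≤k = trans
    (cong₂ (λ l k → (l * n + k) ∸ (s * n + a)) (sym (m+[n∸m]≡n s≤l)) (sym (m+[n∸m]≡n a≤k)))
    (∸-from-+ (s * n + a) (identity s (l ∸ s) a (k ∸ a) n))
    where
      identity : ∀ s u a v n → (s * n + a) + (u * n + v) ≡ (s + u) * n + (a + v)
      identity = ℕSolver.solve-∀

  carry-index : ∀ n {s l k a b} → s < l → suc (a + b) ≡ n
              → (l * n + k) ∸ (s * n + (suc k + a)) ≡ (l ∸ suc s) * n + b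
  carry-index _ {s} {l} {k} {a} {b} s<l refl = trans
    (cong (λ l → (l * suc (a + b) + k) ∸ (s * suc (a + b) + (suc k + a))) (sym (m+[n∸m]≡n s<l)))
    (∸-from-+ (s * suc (a + b) + (suc k + a)) (identity s (l ∸ suc s) k a b))
    where
      identity : ∀ s u k a b
               → (s * suc (a + b) + (suc k + a)) + (u * suc (a + b) + b) ≡ (suc s + u) * suc (a + b) + k
      identity = ℕSolver.solve-∀

  m<n∸o⇒o+m<n : ∀ {m n o} → o ≤ n → m < n ∸ o → o + m < n
  m<n∸o⇒o+m<n {m} {n} {o} o≤n m<n∸o =
    subst (_≤ n) (cong suc (ℕP.+-comm m o)) (m≤o∸n⇒m+n≤o (suc m) o≤n m<n∸o)

  n<1+m+o+[n∸o] : ∀ m {n o} → o ≤ n → n < suc m + o + (n ∸ o)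
  n<1+m+o+[n∸o] m {n} {o} o≤n =
    s≤s (subst (n ≤_) (sym (trans (ℕP.+-assoc m o (n ∸ o)) (cong (_+_ m) (m+[n∸m]≡n o≤n)))) (m≤n+m n m))


module _ {a ℓ} (R : CommutativeRing a ℓ) where
  open CommutativeRing R
  open Sums R
  open import Relation.Binary.Reasoning.Setoid setoid
  open CommSemigroupProperties +-commutativeSemigroup using () renaming (interchange to +-interchange)
  open CommSemigroupProperties *-commutativeSemigroup using () renaming (interchange to *-interchange)

  sumBelow : (ℕ → Carrier) → ℕ → Carrier
  sumBelow f zero    = 0#
  sumBelow f (suc l) = sumBelow f l + f l

  sumTo≈sumBelow : ∀ f m → sumTo f m ≈ sumBelow f (suc m)
  sumTo≈sumBelow f zero    = sym (+-identityˡ _)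
  sumTo≈sumBelow f (suc m) = +-congʳ (sumTo≈sumBelow f m)

  sumBelow-cong : ∀ {f g} l → (∀ i → i < l → f i ≈ g i) → sumBelow f l ≈ sumBelow g l
  sumBelow-cong zero    f≈g = refl
  sumBelow-cong (suc l) f≈g = +-cong (sumBelow-cong l (λ i i<l → f≈g i (m<n⇒m<1+n i<l))) (f≈g l ≤-refl)

  sumBelow-zero : ∀ {f} l → (∀ i → i < l → f i ≈ 0#) → sumBelow f l ≈ 0#
  sumBelow-zero zero    f≈0 = refl
  sumBelow-zero (suc l) f≈0 =
    trans (+-cong (sumBelow-zero l (λ i i<l → f≈0 i (m<n⇒m<1+n i<l))) (f≈0 l ≤-refl)) (+-identityˡ 0#)

  sumBelow-*ʳ : ∀ f x l → sumBelow f l * x ≈ sumBelow (λ i → f i * x) l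
  sumBelow-*ʳ f x zero    = zeroˡ x
  sumBelow-*ʳ f x (suc l) = trans (distribʳ x _ _) (+-congʳ (sumBelow-*ʳ f x l))

  sumBelow-*ˡ : ∀ f x l → x * sumBelow f l ≈ sumBelow (λ i → x * f i) l
  sumBelow-*ˡ f x zero    = zeroʳ x
  sumBelow-*ˡ f x (suc l) = trans (distribˡ x _ _) (+-congʳ (sumBelow-*ˡ f x l))

  sumBelow-+ : ∀ f p q → sumBelow f (p ℕ.+ q) ≈ sumBelow f p + sumBelow (λ i → f (p ℕ.+ i)) q
  sumBelow-+ f p zero    rewrite ℕP.+-identityʳ p = sym (+-identityʳ _)
  sumBelow-+ f p (suc q) rewrite +-suc p q = trans (+-congʳ (sumBelow-+ f p q)) (+-assoc _ _ _)

  sumBelow-blocks : ∀ f n l → sumBelow f (l ℕ.* n) ≈ sumBelow (λ s → sumBelow (λ a → f (s ℕ.* n ℕ.+ a)) n) l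
  sumBelow-blocks f n zero    = refl
  sumBelow-blocks f n (suc l) rewrite ℕP.+-comm n (l ℕ.* n) =
    trans (sumBelow-+ f (l ℕ.* n) n) (+-congʳ (sumBelow-blocks f n l))

  sumTo-cong : ∀ {f g} m → (∀ i → i ≤ m → f i ≈ g i) → sumTo f m ≈ sumTo g m
  sumTo-cong zero    f≈g = f≈g 0 z≤n
  sumTo-cong (suc m) f≈g = +-cong (sumTo-cong m (λ i i≤m → f≈g i (m≤n⇒m≤1+n i≤m))) (f≈g (suc m) ≤-refl)

  sumTo-distrib-+ : ∀ f g m → sumTo (λ i → f i + g i) m ≈ sumTo f m + sumTo g m
  sumTo-distrib-+ f g zero    = refl
  sumTo-distrib-+ f g (suc m) = trans (+-congʳ (sumTo-distrib-+ f g m)) (+-interchange _ _ _ _)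

  sumTo-*ʳ : ∀ f x m → sumTo f m * x ≈ sumTo (λ i → f i * x) m
  sumTo-*ʳ f x zero    = refl
  sumTo-*ʳ f x (suc m) = trans (distribʳ x _ _) (+-congʳ (sumTo-*ʳ f x m))

  sumTo-stable : ∀ {c m p} → (∀ k → m < k → k ≤ p → c k ≈ 0#) → m ≤′ p → sumTo c p ≈ sumTo c m
  sumTo-stable c≈0 (≤′-reflexive ≡.refl) = refl
  sumTo-stable {p = suc p} c≈0 (≤′-step m≤′p) = trans
    (+-cong (sumTo-stable (λ k m<k k≤p → c≈0 k m<k (m≤n⇒m≤1+n k≤p)) m≤′p)
            (c≈0 (suc p) (s≤s (≤′⇒≤ m≤′p)) ≤-refl))
    (+-identityʳ _)

  -- Summing the Cauchy product over the triangle 0 ≤ j ≤ K ≤ N row by row instead of diagonal by diagonal.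
  sumTo-conv : ∀ (f g : ℕ → Carrier) N
             → sumTo (λ K → sumTo (λ j → f j * g (K ∸ j)) K) N ≈ sumTo (λ i → f i * sumTo g (N ∸ i)) N
  sumTo-conv f g zero    = refl
  sumTo-conv f g (suc N) = begin
    sumTo (λ K → sumTo (λ j → f j * g (K ∸ j)) K) N + sumTo (λ j → f j * g (suc N ∸ j)) (suc N)
      ≈⟨ +-congʳ (sumTo-conv f g N) ⟩
    sumTo (λ i → f i * sumTo g (N ∸ i)) N + (sumTo (λ j → f j * g (suc N ∸ j)) N + f (suc N) * g (N ∸ N))
      ≈⟨ +-assoc _ _ _ ⟨
    (sumTo (λ i → f i * sumTo g (N ∸ i)) N + sumTo (λ j → f j * g (suc N ∸ j)) N) + f (suc N) * g (N ∸ N)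
      ≈⟨ +-congʳ (sumTo-distrib-+ _ _ N) ⟨
    sumTo (λ i → f i * sumTo g (N ∸ i) + f i * g (suc N ∸ i)) N + f (suc N) * g (N ∸ N)
      ≈⟨ +-cong (sumTo-cong N (λ i i≤N → trans (sym (distribˡ _ _ _)) (*-congˡ (row-extend i≤N))))
              (*-congˡ diagonal-end) ⟩
    sumTo (λ i → f i * sumTo g (suc N ∸ i)) N + f (suc N) * sumTo g (suc N ∸ suc N)
      ∎
    where
      row-extend : ∀ {i} → i ≤ N → sumTo g (N ∸ i) + g (suc N ∸ i) ≈ sumTo g (suc N ∸ i)
      row-extend {i} i≤N rewrite +-∸-assoc 1 i≤N = refl

      diagonal-end : g (N ∸ N) ≈ sumTo g (N ∸ N)
      diagonal-end rewrite n∸n≡0 N = refl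

  module _ {c : ℕ → Carrier} {m N : ℕ} (2m≤N : m ℕ.+ m ≤ N)
           (c≈0 : ∀ k → m < k → k ≤ N → c k ≈ 0#) where

    sumTo-conv-square : sumTo (conv c) N ≈ sumTo c m * sumTo c m
    sumTo-conv-square = begin
      sumTo (conv c) N                      ≈⟨ sumTo-conv c c N ⟩
      sumTo (λ i → c i * sumTo c (N ∸ i)) N ≈⟨ sumTo-cong N tail-stable ⟩
      sumTo (λ i → c i * sumTo c m) N       ≈⟨ sumTo-*ʳ c _ N ⟨
      sumTo c N * sumTo c m                 ≈⟨ *-congʳ (stable (m+n≤o⇒m≤o m 2m≤N) ≤-refl) ⟩
      sumTo c m * sumTo c m                 ∎
      where
        stable : ∀ {p} → m ≤ p → p ≤ N → sumTo c p ≈ sumTo c m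
        stable m≤p p≤N = sumTo-stable (λ k m<k k≤p → c≈0 k m<k (≤-trans k≤p p≤N)) (≤⇒≤′ m≤p)

        tail-stable : ∀ i → i ≤ N → c i * sumTo c (N ∸ i) ≈ c i * sumTo c m
        tail-stable i i≤N with i ≤? m
        ... | yes i≤m = *-congˡ (stable (m+n≤o⇒m≤o∸n m (≤-trans (+-monoʳ-≤ m i≤m) 2m≤N)) (m∸n≤m N i))
        ... | no  i≰m = trans (*-congʳ ci≈0) (trans (zeroˡ _) (sym (trans (*-congʳ ci≈0) (zeroˡ _))))
          where
            ci≈0 : c i ≈ 0#
            ci≈0 = c≈0 i (≰⇒> i≰m) i≤N

    no-carry : ∀ a b → a ≤ N → b ≤ N → suc N ≤ a ℕ.+ b → c a * c b ≈ 0#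
    no-carry a b a≤N b≤N n≤a+b with a ≤? m | b ≤? m
    ... | yes a≤m | yes b≤m = contradiction (≤-trans n≤a+b (≤-trans (+-mono-≤ a≤m b≤m) 2m≤N)) (n≮n N)
    ... | no  a≰m | _       = trans (*-congʳ (c≈0 a (≰⇒> a≰m) a≤N)) (zeroˡ _)
    ... | yes _   | no  b≰m = trans (*-congˡ (c≈0 b (≰⇒> b≰m) b≤N)) (zeroʳ _)

  module _ {c : ℕ → Carrier} {N : ℕ}
           (block-mult : ∀ l k → k ≤ N → c (l ℕ.* suc N ℕ.+ k) ≈ c (l ℕ.* suc N) * c k)
           (carry≈0 : ∀ a b → a ≤ N → b ≤ N → suc N ≤ a ℕ.+ b → c a * c b ≈ 0#) where
    private
      n : ℕ
      n = suc N

      weight : ℕ → ℕ → Carrier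
      weight l s = c (s ℕ.* n) * c ((l ∸ s) ℕ.* n)

      convTerm : ℕ → ℕ → ℕ → Carrier
      convTerm l k j = c j * c ((l ℕ.* n ℕ.+ k) ∸ j)

      convBelow : ℕ → Carrier
      convBelow k = sumBelow (λ a → c a * c (k ∸ a)) (suc k)

      low-part : ∀ l k s → k ≤ N → s ≤ l
               → sumBelow (λ a → convTerm l k (s ℕ.* n ℕ.+ a)) (suc k) ≈ weight l s * convBelow k
      low-part l k s k≤N s≤l = trans (sumBelow-cong (suc k) factor) (sym (sumBelow-*ˡ _ _ (suc k)))
        where
          factor : ∀ a → a < suc k → convTerm l k (s ℕ.* n ℕ.+ a) ≈ weight l s * (c a * c (k ∸ a))
          factor a (s≤s a≤k) = begin
            c (s ℕ.* n ℕ.+ a) * c ((l ℕ.* n ℕ.+ k) ∸ (s ℕ.* n ℕ.+ a))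
              ≡⟨ cong (λ j → c (s ℕ.* n ℕ.+ a) * c j) (within-block-index n s≤l a≤k) ⟩
            c (s ℕ.* n ℕ.+ a) * c ((l ∸ s) ℕ.* n ℕ.+ (k ∸ a))
              ≈⟨ *-cong (block-mult s a (≤-trans a≤k k≤N))
                        (block-mult (l ∸ s) (k ∸ a) (≤-trans (m∸n≤m k a) k≤N)) ⟩
            (c (s ℕ.* n) * c a) * (c ((l ∸ s) ℕ.* n) * c (k ∸ a))
              ≈⟨ *-interchange _ _ _ _ ⟩
            weight l s * (c a * c (k ∸ a))
              ∎

      carry-part : ∀ l k s → k ≤ N → s < l
                 → sumBelow (λ a → convTerm l k (s ℕ.* n ℕ.+ (suc k ℕ.+ a))) (N ∸ k) ≈ 0#
      carry-part l k s k≤N s<l = sumBelow-zero (N ∸ k) vanish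
        where
          vanish : ∀ a → a < N ∸ k → convTerm l k (s ℕ.* n ℕ.+ (suc k ℕ.+ a)) ≈ 0#
          vanish a a<N∸k = begin
            c (s ℕ.* n ℕ.+ (suc k ℕ.+ a)) * c ((l ℕ.* n ℕ.+ k) ∸ (s ℕ.* n ℕ.+ (suc k ℕ.+ a)))
              ≡⟨ cong (λ j → c (s ℕ.* n ℕ.+ (suc k ℕ.+ a)) * c j) (carry-index n s<l (cong suc (m+[n∸m]≡n a≤N))) ⟩
            c (s ℕ.* n ℕ.+ (suc k ℕ.+ a)) * c ((l ∸ suc s) ℕ.* n ℕ.+ (N ∸ a))
              ≈⟨ *-cong (block-mult s (suc k ℕ.+ a) 1+k+a≤N) (block-mult (l ∸ suc s) (N ∸ a) (m∸n≤m N a)) ⟩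
            (c (s ℕ.* n) * c (suc k ℕ.+ a)) * (c ((l ∸ suc s) ℕ.* n) * c (N ∸ a))
              ≈⟨ *-interchange _ _ _ _ ⟩
            (c (s ℕ.* n) * c ((l ∸ suc s) ℕ.* n)) * (c (suc k ℕ.+ a) * c (N ∸ a))
              ≈⟨ *-congˡ (carry≈0 _ _ 1+k+a≤N (m∸n≤m N a) (n<1+m+o+[n∸o] k a≤N)) ⟩
            (c (s ℕ.* n) * c ((l ∸ suc s) ℕ.* n)) * 0#
              ≈⟨ zeroʳ _ ⟩
            0#
              ∎
            where
              1+k+a≤N : suc k ℕ.+ a ≤ N
              1+k+a≤N = m<n∸o⇒o+m<n k≤N a<N∸k
              a≤N : a ≤ N
              a≤N = m+n≤o⇒n≤o (suc k) 1+k+a≤N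

      full-block : ∀ l k s → k ≤ N → s < l
                 → sumBelow (λ a → convTerm l k (s ℕ.* n ℕ.+ a)) n ≈ weight l s * convBelow k
      full-block l k s k≤N s<l = begin
        sumBelow (λ a → convTerm l k (s ℕ.* n ℕ.+ a)) n
          ≡⟨ cong (λ q → sumBelow (λ a → convTerm l k (s ℕ.* n ℕ.+ a)) (suc q)) (m+[n∸m]≡n k≤N) ⟨
        sumBelow (λ a → convTerm l k (s ℕ.* n ℕ.+ a)) (suc k ℕ.+ (N ∸ k))
          ≈⟨ sumBelow-+ _ (suc k) (N ∸ k) ⟩
        sumBelow (λ a → convTerm l k (s ℕ.* n ℕ.+ a)) (suc k)
          + sumBelow (λ a → convTerm l k (s ℕ.* n ℕ.+ (suc k ℕ.+ a))) (N ∸ k)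
          ≈⟨ +-cong (low-part l k s k≤N (<⇒≤ s<l)) (carry-part l k s k≤N s<l) ⟩
        weight l s * convBelow k + 0#
          ≈⟨ +-identityʳ _ ⟩
        weight l s * convBelow k
          ∎

    conv-blocks : ∀ l k → k ≤ N
                → conv c (l ℕ.* n ℕ.+ k) ≈ sumTo (λ t → c (t ℕ.* n) * c ((l ∸ t) ℕ.* n)) l * conv c k
    conv-blocks l k k≤N = begin
      conv c (l ℕ.* n ℕ.+ k)
        ≈⟨ sumTo≈sumBelow (convTerm l k) (l ℕ.* n ℕ.+ k) ⟩
      sumBelow (convTerm l k) (suc (l ℕ.* n ℕ.+ k))
        ≡⟨ cong (sumBelow (convTerm l k)) (+-suc (l ℕ.* n) k) ⟨
      sumBelow (convTerm l k) (l ℕ.* n ℕ.+ suc k)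
        ≈⟨ sumBelow-+ _ (l ℕ.* n) (suc k) ⟩
      sumBelow (convTerm l k) (l ℕ.* n) + sumBelow (λ a → convTerm l k (l ℕ.* n ℕ.+ a)) (suc k)
        ≈⟨ +-cong (sumBelow-blocks _ n l) (low-part l k l k≤N ≤-refl) ⟩
      sumBelow (λ s → sumBelow (λ a → convTerm l k (s ℕ.* n ℕ.+ a)) n) l + weight l l * convBelow k
        ≈⟨ +-congʳ (sumBelow-cong l (λ s s<l → full-block l k s k≤N s<l)) ⟩
      sumBelow (λ s → weight l s * convBelow k) (suc l)
        ≈⟨ sumBelow-*ʳ _ _ (suc l) ⟨
      sumBelow (weight l) (suc l) * convBelow k
        ≈⟨ *-cong (sym (sumTo≈sumBelow (weight l) l)) (sym (sumTo≈sumBelow (λ a → c a * c (k ∸ a)) k)) ⟩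
      sumTo (weight l) l * conv c k
        ∎

lemma2p1 : ∀ {a ℓ} (R : CommutativeRing a ℓ) (n d : ℕ) (r : ℤ) ⦃ _ : NonZero d ⦄
           → 1 ℕ.< n → 2 ℕ.≤ d
           → (+ n ℤ.- + ((n ℕ.∸ 1) ℕ.* d ℕ./ 2)) ℤ.≤ r → r ℤ.≤ + n
           → (+ d) ℤD.∣ (+ n ℤ.- r)
           → (c : ℕ → CommutativeRing.Carrier R)
           → let open CommutativeRing R
                 open Sums R
                 m = ∣ + n ℤ.- r ∣ ℕ./ d
             in (∀ k → m ℕ.< k → k ℕ.≤ n ℕ.∸ 1 → c k ≈ 0#)
                → (sumTo (conv c) (n ℕ.∸ 1) ≈ sumTo c m * sumTo c m)
                  × ((∀ l k → k ℕ.≤ n ℕ.∸ 1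
                        → (¬ (c (l ℕ.* n) ≈ 0#)) × (c (l ℕ.* n ℕ.+ k) ≈ c (l ℕ.* n) * c k))
                     → ∀ l k → k ℕ.≤ n ℕ.∸ 1
                     → conv c (l ℕ.* n ℕ.+ k)
                       ≈ sumTo (λ t → c (t ℕ.* n) * c ((l ℕ.∸ t) ℕ.* n)) l * conv c k)
lemma2p1 R zero    d r () _ _ _ _ _ _
lemma2p1 R (suc N) d r _ _ lo hi _ c c≈0 =
  sumTo-conv-square R 2m≤N c≈0 ,
  λ hyp → conv-blocks R (λ l k k≤N → proj₂ (hyp l k k≤N)) (no-carry R 2m≤N c≈0)
  where
    m : ℕ
    m = ∣ + suc N ℤ.- r ∣ ℕ./ d
    2m≤N : m ℕ.+ m ≤ N
    2m≤N = window-bound (suc N) d r lo hi
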